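{- Let $s\geq r\geq 2$ be integers and let $F$ be an arbitrary graph. If $\mathcal{H}$ is an $n$-vertex $r$-graph containing no copy of $F^r$, then $\mathcal{N}(K_s^{(r)},\mathcal{H})\leq \mathrm{ex}_s(n,F^s)$. In particular, $\mathrm{ex}_r(n,K_s^{(r)},F^r)\leq\mathrm{ex}_s(n,F^s)$.
   Context: An $r$-graph is a hypergraph all of whose hyperedges have exactly $r$ vertices. $K_s^{(r)}$ is the complete $r$-graph on $s$ vertices. For a graph $F$ and $q\geq 2$, the $q$-expansion $F^q$ is obtained from $F$ by adding $q-2$ new vertices to each edge, all new vertices distinct from each other and from $V(F)$. $\mathcal{N}(K_s^{(r)},\mathcal{H})$ is the number of copies of $K_s^{(r)}$ in $\mathcal{H}$. $\mathrm{ex}_s(n,\mathcal{F})$ is the maximum number of hyperedges in an $n$-vertex $s$-graph with no copy of $\mathcal{F}$; $\mathrm{ex}_r(n,\mathcal{H},\mathcal{F})$ is the maximum number of copies of $\mathcal{H}$ in an $n$-vertex $r$-graph with no copy of $\mathcal{F}$. -}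

module Defs where

open import Data.Nat using (ℕ; zero; suc; _+_; _*_; _∸_; _≡ᵇ_)
open import Data.Bool using (Bool; true; false; _∧_; _∨_; not; if_then_else_)
open import Data.Fin using (Fin; _↑ˡ_; _↑ʳ_; combine)
open import Data.Fin.Subset using (Subset; ⁅_⁆; _∪_; ⋃; ∣_∣; _⊆_; ⊥)
open import Data.Fin.Subset.Properties using (_⊆?_)
open import Data.Vec using (Vec; []; _∷_; lookup)
open import Data.List using (List; []; _∷_; [_]; map; _++_; allFin; filterᵇ; length)
open import Data.Bool.ListAction using (and)
open import Data.Product using (_×_; _,_; proj₁; proj₂; Σ)
open import Data.Sum using (_⊎_)
open import Relation.Nullary using (¬_)
open import Relation.Nullary.Decidable using (⌊_⌋)
open import Relation.Binary.PropositionalEquality using (_≡_)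
open import Function.Definitions using (Injective)

record Graph : Set where
  field
    m    : ℕ
    k    : ℕ
    ends : Fin k → Fin m × Fin m
    loopless : ∀ i → ¬ (proj₁ (ends i) ≡ proj₂ (ends i))
    simple   : ∀ i j →
               ((proj₁ (ends i) ≡ proj₁ (ends j)) × (proj₂ (ends i) ≡ proj₂ (ends j)))
             ⊎ ((proj₁ (ends i) ≡ proj₂ (ends j)) × (proj₂ (ends i) ≡ proj₁ (ends j)))
             → i ≡ j

HGraph : ℕ → Set
HGraph n = Subset n → Bool

IsUniform : ∀ {n} → ℕ → HGraph n → Set
IsUniform r H = ∀ S → H S ≡ true → ∣ S ∣ ≡ r

allSubsets : ∀ n → List (Subset n)
allSubsets zero    = [ [] ]
allSubsets (suc n) = map (false ∷_) (allSubsets n) ++ map (true ∷_) (allSubsets n)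

edgeCount : ∀ {n} → HGraph n → ℕ
edgeCount {n} H = length (filterᵇ H (allSubsets n))

image : ∀ {N n} → (Fin N → Fin n) → Subset N → Subset n
image {N} φ S = ⋃ (map (λ y → if lookup S y then ⁅ φ y ⁆ else ⊥) (allFin N))

record Pattern : Set where
  field
    N    : ℕ
    e    : ℕ
    edge : Fin e → Subset N

ContainsCopy : ∀ {n} → HGraph n → Pattern → Set
ContainsCopy {n} H P =
  Σ (Fin (Pattern.N P) → Fin n) λ φ →
    Injective _≡_ _≡_ φ × (∀ i → H (image φ (Pattern.edge P i)) ≡ true)

-- q-expansion F^q: vertices are V(F) = Fin m together with q-2 new
-- vertices (i , j), j < q-2, for each edge i; these are encoded in
-- Fin (m + k * (q ∸ 2)).
expansion : Graph → ℕ → Pattern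
expansion F q = record
  { N    = m + k * (q ∸ 2)
  ; e    = k
  ; edge = λ i →
      ⁅ core (proj₁ (ends i)) ⁆ ∪ ⁅ core (proj₂ (ends i)) ⁆
        ∪ ⋃ (map (λ j → ⁅ m ↑ʳ combine i j ⁆) (allFin (q ∸ 2)))
  }
  where
  open Graph F
  core : Fin m → Fin (m + k * (q ∸ 2))
  core u = u ↑ˡ (k * (q ∸ 2))

-- Copies of K_s^(r) in an r-graph H: s-element vertex sets S all of
-- whose r-element subsets are hyperedges of H.

IsKsCopy : ∀ {n} → ℕ → ℕ → HGraph n → Subset n → Bool
IsKsCopy {n} r s H S =
  (∣ S ∣ ≡ᵇ s) ∧
  and (map (λ T → not (⌊ T ⊆? S ⌋ ∧ (∣ T ∣ ≡ᵇ r)) ∨ H T) (allSubsets n))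

numKs : ∀ {n} → ℕ → ℕ → HGraph n → ℕ
numKs {n} r s H = length (filterᵇ (IsKsCopy r s H) (allSubsets n))

-- Let G be the s-graph whose hyperedges are the vertex sets of the copies of K_s^(r) in H,
-- so that G has exactly 𝒩(K_s^(r), H) hyperedges. The vertices of F^q are V(F) together with
-- q - 2 new vertices per edge of F, so for r ≤ s the expansion F^r embeds into F^s by keeping
-- V(F) and sending the new vertices of each edge to some of the new vertices of the same edge.
-- A copy of F^s in G therefore maps every hyperedge of F^r injectively into an s-clique of H,
-- i.e. onto an r-subset of such a clique, which is a hyperedge of H: a copy of F^r in H.
module Submission where

open import Defs
open import Data.Bool using (true; false; T; not; _∧_; _∨_; if_then_else_)
open import Data.Bool.Properties using (T-≡; T-∧)
open import Data.Bool.ListAction using (all)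
open import Data.Empty using (⊥-elim)
open import Data.Fin using (Fin; combine; remQuot; splitAt; join; inject≤)
open import Data.Fin.Properties
  using (splitAt-↑ˡ; splitAt-↑ʳ; join-splitAt; remQuot-combine; combine-remQuot; inject≤-injective)
open import Data.Fin.Subset using (Subset; ⁅_⁆; _∪_; ⋃; ∣_∣; _⊆_; _∈_; _∉_; inside; outside)
  renaming (⊥ to ∅)
open import Data.Fin.Subset.Properties
  using (_⊆?_; ∉⊥; x∈p∪q⁻; x∈p∪q⁺; x∈⁅x⁆; x∈⁅y⁆⇒x≡y; ∪-identityˡ; ∣⊥∣≡0; ⊆-antisym)
open import Data.List using (List; []; _∷_; map; allFin; length)
open import Data.List.Properties using (map-∘; length-map; length-tabulate)
open import Data.List.Membership.Propositional using (find) renaming (_∈_ to _∈ₗ_)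
open import Data.List.Membership.Propositional.Properties
  using (∈-map⁺; ∈-map⁻; ∈-++⁺ˡ; ∈-++⁺ʳ; ∈-allFin)
open import Data.List.Relation.Unary.Any as Any using (Any; here; there)
import Data.List.Relation.Unary.Any.Properties as Any
open import Data.List.Relation.Unary.All as All using (All; universal)
import Data.List.Relation.Unary.All.Properties as All
open import Data.List.Relation.Unary.AllPairs using (_∷_)
open import Data.List.Relation.Unary.Unique.Propositional using (Unique)
open import Data.List.Relation.Unary.Unique.Propositional.Properties
  using (allFin⁺; Unique[x∷xs]⇒x∉xs) renaming (map⁺ to Unique-map⁺)
open import Data.Nat using (ℕ; suc; _+_; _*_; _∸_; _≤_; _≡ᵇ_)
open import Data.Nat.Properties using (≤-refl; ∸-monoˡ-≤; m+[n∸m]≡n; ≡ᵇ⇒≡; ≡⇒≡ᵇ)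
open import Data.Product using (Σ; _×_; _,_; proj₁; proj₂; ∃; uncurry)
import Data.Product as Product
open import Data.Product.Properties using (,-injective)
open import Data.Sum using (_⊎_; inj₁; inj₂)
import Data.Sum as Sum
open import Data.Sum.Properties using (inj₁-injective; inj₂-injective)
open import Data.Vec using ([]; _∷_; lookup; here; there)
open import Data.Vec.Properties using (lookup⇒[]=; []=⇒lookup)
open import Function using (_∘_; Equivalence)
open import Function.Definitions using (Injective)
open import Relation.Nullary using (¬_)
open import Relation.Nullary.Decidable using (⌊_⌋; fromWitness)
open import Relation.Binary.PropositionalEquality
  using (_≡_; _≢_; refl; sym; trans; cong; module ≡-Reasoning)

private
  variable
    n N : ℕ

x∈⋃ps⁺ : ∀ {x : Fin n} {ps} → Any (x ∈_) ps → x ∈ ⋃ ps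
x∈⋃ps⁺ (here x∈p)   = x∈p∪q⁺ (inj₁ x∈p)
x∈⋃ps⁺ (there x∈ps) = x∈p∪q⁺ (inj₂ (x∈⋃ps⁺ x∈ps))

x∈⋃ps⁻ : ∀ {x : Fin n} ps → x ∈ ⋃ ps → Any (x ∈_) ps
x∈⋃ps⁻ []       x∈∅ = ⊥-elim (∉⊥ x∈∅)
x∈⋃ps⁻ (p ∷ ps) x∈⋃ with x∈p∪q⁻ p (⋃ ps) x∈⋃
... | inj₁ x∈p  = here x∈p
... | inj₂ x∈ps = there (x∈⋃ps⁻ ps x∈ps)

∣⁅x⁆∪p∣≡1+∣p∣ : ∀ (x : Fin n) p → x ∉ p → ∣ ⁅ x ⁆ ∪ p ∣ ≡ suc ∣ p ∣
∣⁅x⁆∪p∣≡1+∣p∣ Fin.zero    (inside ∷ p)  x∉p = ⊥-elim (x∉p here)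
∣⁅x⁆∪p∣≡1+∣p∣ Fin.zero    (outside ∷ p) x∉p = cong (suc ∘ ∣_∣) (∪-identityˡ p)
∣⁅x⁆∪p∣≡1+∣p∣ (Fin.suc x) (inside ∷ p)  x∉p = cong suc (∣⁅x⁆∪p∣≡1+∣p∣ x p (x∉p ∘ there))
∣⁅x⁆∪p∣≡1+∣p∣ (Fin.suc x) (outside ∷ p) x∉p = ∣⁅x⁆∪p∣≡1+∣p∣ x p (x∉p ∘ there)

fromList : List (Fin n) → Subset n
fromList xs = ⋃ (map ⁅_⁆ xs)

∈-fromList⁺ : ∀ {x : Fin n} {xs} → x ∈ₗ xs → x ∈ fromList xs
∈-fromList⁺ = x∈⋃ps⁺ ∘ Any.map⁺ ∘ Any.map (λ { refl → x∈⁅x⁆ _ })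

∈-fromList⁻ : ∀ {x : Fin n} xs → x ∈ fromList xs → x ∈ₗ xs
∈-fromList⁻ xs = Any.map (x∈⁅y⁆⇒x≡y _) ∘ Any.map⁻ ∘ x∈⋃ps⁻ (map ⁅_⁆ xs)

∣fromList∣≡length : ∀ {xs : List (Fin n)} → Unique xs → ∣ fromList xs ∣ ≡ length xs
∣fromList∣≡length {n} {xs = []}     _                 = ∣⊥∣≡0 n
∣fromList∣≡length {n} {xs = x ∷ xs} u@(_ ∷ xs-unique) = trans
  (∣⁅x⁆∪p∣≡1+∣p∣ x (fromList xs) (Unique[x∷xs]⇒x∉xs u ∘ ∈-fromList⁻ xs))
  (cong suc (∣fromList∣≡length xs-unique))

module _ (φ : Fin N → Fin n) (S : Subset N) where

  private
    piece : Fin N → Subset n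
    piece x = if lookup S x then ⁅ φ x ⁆ else ∅

    ∈-piece⁻ : ∀ x {y} → y ∈ piece x → x ∈ S × φ x ≡ y
    ∈-piece⁻ x y∈ with lookup S x in eq
    ... | true  = lookup⇒[]= x S eq , sym (x∈⁅y⁆⇒x≡y _ y∈)
    ... | false = ⊥-elim (∉⊥ y∈)

  ∈-image⁺ : ∀ {x} → x ∈ S → φ x ∈ image φ S
  ∈-image⁺ {x} x∈S = x∈⋃ps⁺ (Any.map⁺ (Any.map (λ { refl → φx∈piece }) (∈-allFin x)))
    where
    φx∈piece : φ x ∈ piece x
    φx∈piece rewrite []=⇒lookup x∈S = x∈⁅x⁆ (φ x)

  ∈-image⁻ : ∀ {y} → y ∈ image φ S → ∃ λ x → x ∈ S × φ x ≡ y
  ∈-image⁻ y∈ with find (Any.map⁻ (x∈⋃ps⁻ (map piece (allFin N)) y∈))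
  ... | x , _ , y∈piece = x , ∈-piece⁻ x y∈piece

image-fromList : ∀ (φ : Fin N → Fin n) xs → image φ (fromList xs) ≡ fromList (map φ xs)
image-fromList φ xs = ⊆-antisym image⊆ ⊆image
  where
  image⊆ : image φ (fromList xs) ⊆ fromList (map φ xs)
  image⊆ y∈ with ∈-image⁻ φ (fromList xs) y∈
  ... | x , x∈xs , refl = ∈-fromList⁺ (∈-map⁺ φ (∈-fromList⁻ xs x∈xs))

  ⊆image : fromList (map φ xs) ⊆ image φ (fromList xs)
  ⊆image y∈ with ∈-map⁻ φ (∈-fromList⁻ (map φ xs) y∈)
  ... | x , x∈xs , refl = ∈-image⁺ φ (fromList xs) (∈-fromList⁺ x∈xs)

∣image-fromList∣ : ∀ {φ : Fin N → Fin n} → Injective _≡_ _≡_ φ →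
                   ∀ {xs} → Unique xs → ∣ image φ (fromList xs) ∣ ≡ length xs
∣image-fromList∣ {φ = φ} φ-inj {xs} xs-unique = begin
  ∣ image φ (fromList xs) ∣  ≡⟨ cong ∣_∣ (image-fromList φ xs) ⟩
  ∣ fromList (map φ xs) ∣    ≡⟨ ∣fromList∣≡length (Unique-map⁺ φ-inj xs-unique) ⟩
  length (map φ xs)          ≡⟨ length-map φ xs ⟩
  length xs                  ∎
  where open ≡-Reasoning

image-∘-⊆ : ∀ {M} (φ : Fin N → Fin n) (ι : Fin M → Fin N) {S T} →
            (∀ {x} → x ∈ S → ι x ∈ T) → image (φ ∘ ι) S ⊆ image φ T
image-∘-⊆ φ ι {S} {T} ι-maps y∈ with ∈-image⁻ (φ ∘ ι) S y∈
... | x , x∈S , refl = ∈-image⁺ φ T (ι-maps x∈S)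

∈-allSubsets : ∀ (S : Subset n) → S ∈ₗ allSubsets n
∈-allSubsets []                = here refl
∈-allSubsets {suc n} (false ∷ S) = ∈-++⁺ˡ (∈-map⁺ (false ∷_) (∈-allSubsets S))
∈-allSubsets {suc n} (true ∷ S)  =
  ∈-++⁺ʳ (map (false ∷_) (allSubsets n)) (∈-map⁺ (true ∷_) (∈-allSubsets S))

not-∨-elim : ∀ {a b} → T (not a ∨ b) → T a → T b
not-∨-elim {true} b _ = b

module _ {n} (r s : ℕ) (H : HGraph n) {S : Subset n} (S-clique : IsKsCopy r s H S ≡ true) where

  private
    split : T (∣ S ∣ ≡ᵇ s) × T (all _ (allSubsets n))
    split = Equivalence.to T-∧ (Equivalence.from T-≡ S-clique)

  IsKsCopy-size : ∣ S ∣ ≡ s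
  IsKsCopy-size = ≡ᵇ⇒≡ ∣ S ∣ s (proj₁ split)

  IsKsCopy-⊆ : ∀ {R} → R ⊆ S → ∣ R ∣ ≡ r → H R ≡ true
  IsKsCopy-⊆ {R} R⊆S ∣R∣≡r = Equivalence.to T-≡ (not-∨-elim R-clause R-face)
    where
    R-clause : T (not (⌊ R ⊆? S ⌋ ∧ (∣ R ∣ ≡ᵇ r)) ∨ H R)
    R-clause = All.lookup (All.all⁺ _ _ (proj₂ split)) (∈-allSubsets R)

    R-face : T (⌊ R ⊆? S ⌋ ∧ (∣ R ∣ ≡ᵇ r))
    R-face = Equivalence.from T-∧ (fromWitness (λ {x} → R⊆S {x}) , ≡⇒≡ᵇ ∣ R ∣ r ∣R∣≡r)

module Expansion (F : Graph) where
  open Graph F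

  vertices : ℕ → ℕ
  vertices q = Pattern.N (expansion F q)

  edge : ∀ q → Fin k → Subset (vertices q)
  edge q = Pattern.edge (expansion F q)

  Vertex : ℕ → Set
  Vertex q = Fin m ⊎ (Fin k × Fin (q ∸ 2))

  encode : ∀ q → Vertex q → Fin (vertices q)
  encode q = join m (k * (q ∸ 2)) ∘ Sum.map₂ (uncurry combine)

  decode : ∀ q → Fin (vertices q) → Vertex q
  decode q = Sum.map₂ (remQuot (q ∸ 2)) ∘ splitAt m

  decode-encode : ∀ q v → decode q (encode q v) ≡ v
  decode-encode q (inj₁ u)       = cong (Sum.map₂ _) (splitAt-↑ˡ m u _)
  decode-encode q (inj₂ (i , j)) =
    trans (cong (Sum.map₂ _) (splitAt-↑ʳ m _ (combine i j))) (cong inj₂ (remQuot-combine i j))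

  encode-decode : ∀ q x → encode q (decode q x) ≡ x
  encode-decode q x =
    trans (cong (join m _) (combine-remQuot-on (splitAt m x))) (join-splitAt m _ x)
    where
    combine-remQuot-on : ∀ (z : Fin m ⊎ Fin (k * (q ∸ 2))) →
                         Sum.map₂ (uncurry combine) (Sum.map₂ (remQuot {k} (q ∸ 2)) z) ≡ z
    combine-remQuot-on (inj₁ u) = refl
    combine-remQuot-on (inj₂ z) = cong inj₂ (combine-remQuot {k} (q ∸ 2) z)

  encode-injective : ∀ q → Injective _≡_ _≡_ (encode q)
  encode-injective q {v} {w} e = begin
    v                       ≡⟨ sym (decode-encode q v) ⟩
    decode q (encode q v)   ≡⟨ cong (decode q) e ⟩
    decode q (encode q w)   ≡⟨ decode-encode q w ⟩
    w                       ∎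
    where open ≡-Reasoning

  decode-injective : ∀ q → Injective _≡_ _≡_ (decode q)
  decode-injective q {x} {y} e = begin
    x                       ≡⟨ sym (encode-decode q x) ⟩
    encode q (decode q x)   ≡⟨ cong (encode q) e ⟩
    encode q (decode q y)   ≡⟨ encode-decode q y ⟩
    y                       ∎
    where open ≡-Reasoning

  vertexList : ∀ q → Fin k → List (Vertex q)
  vertexList q i =
    inj₁ (proj₁ (ends i)) ∷ inj₁ (proj₂ (ends i)) ∷ map (λ j → inj₂ (i , j)) (allFin (q ∸ 2))

  vertexList-unique : ∀ q i → Unique (vertexList q i)
  vertexList-unique q i =
      ((loopless i ∘ inj₁-injective) All.∷ new≢ (proj₁ (ends i)))
    ∷ new≢ (proj₂ (ends i))
    ∷ Unique-map⁺ (λ { refl → refl }) (allFin⁺ (q ∸ 2))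
    where
    new≢ : ∀ u → All (inj₁ u ≢_) (map (λ j → inj₂ (i , j)) (allFin (q ∸ 2)))
    new≢ u = All.map⁺ (universal (λ _ ()) _)

  length-vertexList : ∀ {q} → 2 ≤ q → ∀ i → length (vertexList q i) ≡ q
  length-vertexList {q} 2≤q i = trans
    (cong (2 +_) (trans (length-map _ (allFin (q ∸ 2))) (length-tabulate _)))
    (m+[n∸m]≡n 2≤q)

  edgeList : ∀ q → Fin k → List (Fin (vertices q))
  edgeList q i = map (encode q) (vertexList q i)

  edge≡fromList : ∀ q i → edge q i ≡ fromList (edgeList q i)
  edge≡fromList q i = cong (λ new → ⁅ u ⁆ ∪ ⁅ v ⁆ ∪ ⋃ new)
    (trans (map-∘ (allFin (q ∸ 2))) (cong (map ⁅_⁆) (map-∘ (allFin (q ∸ 2)))))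
    where
    u v : Fin (vertices q)
    u = encode q (inj₁ (proj₁ (ends i)))
    v = encode q (inj₁ (proj₂ (ends i)))

  ∣image-edge∣ : ∀ {q n} {ψ : Fin (vertices q) → Fin n} → 2 ≤ q → Injective _≡_ _≡_ ψ →
                 ∀ i → ∣ image ψ (edge q i) ∣ ≡ q
  ∣image-edge∣ {q} {ψ = ψ} 2≤q ψ-injective i = begin
    ∣ image ψ (edge q i) ∣                ≡⟨ cong (∣_∣ ∘ image ψ) (edge≡fromList q i) ⟩
    ∣ image ψ (fromList (edgeList q i)) ∣ ≡⟨ ∣image-fromList∣ ψ-injective edgeList-unique ⟩
    length (edgeList q i)                 ≡⟨ length-map (encode q) (vertexList q i) ⟩
    length (vertexList q i)               ≡⟨ length-vertexList 2≤q i ⟩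
    q                                     ∎
    where
    open ≡-Reasoning
    edgeList-unique : Unique (edgeList q i)
    edgeList-unique = Unique-map⁺ (encode-injective q) (vertexList-unique q i)

  module _ {q q′ : ℕ} (q≤q′ : q ≤ q′) where

    widen : Vertex q → Vertex q′
    widen = Sum.map₂ (Product.map₂ (λ j → inject≤ j (∸-monoˡ-≤ 2 q≤q′)))

    widen-injective : Injective _≡_ _≡_ widen
    widen-injective {inj₁ _}       {inj₁ _}         refl = refl
    widen-injective {inj₂ (i , j)} {inj₂ (_ , j′)} e
      with refl , e′ ← ,-injective (inj₂-injective e)
      = cong (λ j → inj₂ (i , j)) (inject≤-injective _ _ j j′ e′)

    widen-vertexList : ∀ i {v} → v ∈ₗ vertexList q i → widen v ∈ₗ vertexList q′ i
    widen-vertexList i (here refl)         = here refl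
    widen-vertexList i (there (here refl)) = there (here refl)
    widen-vertexList i (there (there v∈))  with ∈-map⁻ _ v∈
    ... | j , _ , refl = there (there (∈-map⁺ _ (∈-allFin _)))

    embed : Fin (vertices q) → Fin (vertices q′)
    embed = encode q′ ∘ widen ∘ decode q

    embed-encode : ∀ v → embed (encode q v) ≡ encode q′ (widen v)
    embed-encode v = cong (encode q′ ∘ widen) (decode-encode q v)

    embed-injective : Injective _≡_ _≡_ embed
    embed-injective = decode-injective q ∘ widen-injective ∘ encode-injective q′

    embed-edge : ∀ i {x} → x ∈ edge q i → embed x ∈ edge q′ i
    embed-edge i x∈ rewrite edge≡fromList q i | edge≡fromList q′ i
      with ∈-map⁻ (encode q) (∈-fromList⁻ (edgeList q i) x∈)
    ... | v , v∈ , refl rewrite embed-encode v =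
      ∈-fromList⁺ (∈-map⁺ (encode q′) (widen-vertexList i v∈))

  copy-in-cliques⇒copy : ∀ {r s n} → 2 ≤ r → r ≤ s → (H : HGraph n) →
                         ContainsCopy (IsKsCopy r s H) (expansion F s) →
                         ContainsCopy H (expansion F r)
  copy-in-cliques⇒copy {r} {s} {n} 2≤r r≤s H (φ , φ-injective , φ-edge) =
    ψ , ψ-injective , ψ-edge
    where
    ψ : Fin (vertices r) → Fin n
    ψ = φ ∘ embed r≤s

    ψ-injective : Injective _≡_ _≡_ ψ
    ψ-injective = embed-injective r≤s ∘ φ-injective

    ψ-edge : ∀ i → H (image ψ (edge r i)) ≡ true
    ψ-edge i = IsKsCopy-⊆ r s H (φ-edge i)
      (image-∘-⊆ φ (embed r≤s) (embed-edge r≤s i)) (∣image-edge∣ 2≤r ψ-injective i)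

open Expansion using (copy-in-cliques⇒copy)

lemma3p1 : (s r : ℕ) → 2 ≤ r → r ≤ s → (F : Graph) → (n : ℕ) → (H : HGraph n)
         → IsUniform r H → ¬ ContainsCopy H (expansion F r)
         → Σ (HGraph n) λ G → IsUniform s G × ¬ ContainsCopy G (expansion F s)
             × numKs r s H ≤ edgeCount G
lemma3p1 s r 2≤r r≤s F n H _ H-free =
  IsKsCopy r s H ,
  (λ _ → IsKsCopy-size r s H) ,
  H-free ∘ copy-in-cliques⇒copy F 2≤r r≤s H ,
  ≤-refl
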